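{- Let $A=\{a_1,a_2,a_3,a_4,a_5\}$ be a set of positive integers with $a_1<a_2<a_3<a_4<a_5$. Suppose that $a_i-a_{i-1}\ne 2a_1$ for exactly one $i\in\{2,3,4,5\}$ and $a_i-a_{i-1}=2a_1$ for the remaining $i\in\{2,3,4,5\}$. Then $\left|4^{\wedge}_{\pm}A\right|\ge 26$.
   Context: For a positive integer $h$ and a finite set of integers $A=\{a_1,\ldots,a_k\}$ (distinct elements), the restricted $h$-fold signed sumset is $h^{\wedge}_{\pm}A=\left\{\sum_{i=1}^k\lambda_i a_i:\lambda_i\in\{ -1,0,1\},\ \sum_{i=1}^k|\lambda_i|=h\right\}$. -}

module Defs where

open import Data.Nat as ℕ using (ℕ; zero; suc)
open import Data.Integer as ℤ using (ℤ; +_; 0ℤ)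
import Data.Fin as Fin
open Fin using (Fin)
open import Data.Vec using (Vec; []; _∷_; lookup)
open import Data.List using (List; []; _∷_; map; concatMap; filterᵇ; deduplicate; length)
open import Data.Bool using (Bool)
open import Relation.Nullary.Decidable using (⌊_⌋)

data Sign : Set where
  neg zer pos : Sign

signs : List Sign
signs = neg ∷ zer ∷ pos ∷ []

∣_∣ˢ : Sign → ℕ
∣ neg ∣ˢ = 1
∣ zer ∣ˢ = 0
∣ pos ∣ˢ = 1

act : Sign → ℤ → ℤ
act neg a = ℤ.- a
act zer a = 0ℤ
act pos a = a

allSigns : (k : ℕ) → List (Vec Sign k)
allSigns zero = [] ∷ []
allSigns (suc k) = concatMap (λ s → map (s ∷_) (allSigns k)) signs

weight : ∀ {k} → Vec Sign k → ℕ
weight [] = 0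
weight (s ∷ v) = ∣ s ∣ˢ ℕ.+ weight v

signedSum : ∀ {k} → Vec Sign k → Vec ℤ k → ℤ
signedSum [] [] = 0ℤ
signedSum (s ∷ v) (a ∷ as) = act s a ℤ.+ signedSum v as

-- h^∧_± A as a list of integers (possibly with repetitions), A given by the
-- vector of its (distinct) elements
restrictedSignedSumList : (h : ℕ) {k : ℕ} → Vec ℤ k → List ℤ
restrictedSignedSumList h {k} a =
  map (λ v → signedSum v a) (filterᵇ (λ v → ⌊ weight v ℕ.≟ h ⌋) (allSigns k))

restrictedSignedSumsetSize : (h : ℕ) {k : ℕ} → Vec ℤ k → ℕ
restrictedSignedSumsetSize h a = length (deduplicate ℤ._≟_ (restrictedSignedSumList h a))

gapAt : (a₁ a₂ a₃ a₄ a₅ : ℕ) → Fin 4 → ℕ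
gapAt a₁ a₂ a₃ a₄ a₅ Fin.zero = a₂ ℕ.∸ a₁
gapAt a₁ a₂ a₃ a₄ a₅ (Fin.suc Fin.zero) = a₃ ℕ.∸ a₂
gapAt a₁ a₂ a₃ a₄ a₅ (Fin.suc (Fin.suc Fin.zero)) = a₄ ℕ.∸ a₃
gapAt a₁ a₂ a₃ a₄ a₅ (Fin.suc (Fin.suc (Fin.suc Fin.zero))) = a₅ ℕ.∸ a₄

-- Let d be the exceptional gap, so each aᵢ is p a₁ + q d with explicit integers p, q, and a
-- signed sum of A is a linear form in (a₁, d). Since d ≠ 2a₁, either d < 2a₁ or d > 2a₁; in either
-- regime, writing the form in the basis (d, 2a₁ − d) resp. (a₁, d − 2a₁) shows that it is positive
-- as soon as both coordinates are nonnegative and not both zero. For each position of the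
-- exceptional gap and each regime we exhibit 26 weight-4 sign vectors whose consecutive
-- differences are positive in this sense; their signed sums are then 26 distinct elements of 4^∧_± A.

module Submission where

open import Defs
open import Data.Nat as ℕ using (ℕ; zero; suc; _<_; _≤_; _*_; _∸_; z≤n; s≤s)
import Data.Nat.Properties as ℕ
open import Data.Integer as ℤ using (ℤ; +_; 0ℤ)
import Data.Integer.Properties as ℤ
open import Data.Integer.Tactic.RingSolver using (solve-∀)
open import Data.Fin using (Fin; _≟_)
open import Data.Fin.Patterns using (0F; 1F; 2F; 3F)
import Data.Fin.Properties as Fin
open import Data.Vec as Vec using (Vec; []; _∷_; lookup; replicate; _[_]≔_; toList)
import Data.Vec.Properties as Vec
open import Data.Vec.Relation.Binary.Pointwise.Inductive using (Pointwise; []; _∷_)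
open import Data.List as List using (List; []; _∷_; length; deduplicate; map)
import Data.List.Properties as List
open import Data.List.Relation.Unary.All as All using (All)
open import Data.List.Relation.Unary.Any using (here; there; _─_)
import Data.List.Relation.Unary.AllPairs as AllPairs
open import Data.List.Relation.Unary.Linked as Linked using (Linked)
import Data.List.Relation.Unary.Linked.Properties as Linked
open import Data.List.Relation.Unary.Unique.Propositional using (Unique)
open import Data.List.Membership.Propositional using (_∈_)
open import Data.List.Membership.Propositional.Properties
  using (∈-map⁺; ∈-map⁻; ∈-concatMap⁺; ∈-filter⁺; ∈-deduplicate⁺)
open import Data.List.Relation.Binary.Subset.Propositional using (_⊆_)
open import Data.Product using (∃; ∃-syntax; _×_; _,_; proj₁; proj₂)
open import Data.Empty using (⊥-elim)
open import Level using (0ℓ)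
open import Relation.Binary using (Rel; tri<; tri≈; tri>)
open import Relation.Binary.PropositionalEquality
open import Relation.Nullary using (Dec; yes; no; _×-dec_)
open import Relation.Nullary.Decidable using (toWitness; fromWitness; T?; ⌊_⌋)

module _ {a} {A : Set a} where

  ∈-─⁺ : ∀ {x y} {xs : List A} (y∈xs : y ∈ xs) → x ∈ xs → x ≢ y → x ∈ (xs ─ y∈xs)
  ∈-─⁺ (here refl) (here refl) x≢y = ⊥-elim (x≢y refl)
  ∈-─⁺ (here _)    (there x∈xs) _  = x∈xs
  ∈-─⁺ (there _)   (here refl) _   = here refl
  ∈-─⁺ (there y∈xs) (there x∈xs) x≢y = there (∈-─⁺ y∈xs x∈xs x≢y)

  Unique-⊆⇒length-≤ : ∀ {xs ys : List A} → Unique xs → xs ⊆ ys → length xs ≤ length ys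
  Unique-⊆⇒length-≤ AllPairs.[] _ = z≤n
  Unique-⊆⇒length-≤ {x ∷ xs} {ys} (x≢xs AllPairs.∷ xs!) x∷xs⊆ys =
    ℕ.≤-trans (s≤s (Unique-⊆⇒length-≤ xs! xs⊆ys─x))
              (ℕ.≤-reflexive (sym (List.length-removeAt′ ys _)))
    where
    x∈ys : x ∈ ys
    x∈ys = x∷xs⊆ys (here refl)
    xs⊆ys─x : xs ⊆ (ys ─ x∈ys)
    xs⊆ys─x z∈xs = ∈-─⁺ x∈ys (x∷xs⊆ys (there z∈xs)) (≢-sym (All.lookup x≢xs z∈xs))

extensions : ∀ k → Sign → List (Vec Sign (suc k))
extensions k s = map (s ∷_) (allSigns k)

∈-allSigns : ∀ {k} (v : Vec Sign k) → v ∈ allSigns k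
∈-allSigns []              = here refl
∈-allSigns {suc k} (neg ∷ v) = ∈-concatMap⁺ (extensions k) {signs} (here (∈-map⁺ _ (∈-allSigns v)))
∈-allSigns {suc k} (zer ∷ v) = ∈-concatMap⁺ (extensions k) {signs} (there (here (∈-map⁺ _ (∈-allSigns v))))
∈-allSigns {suc k} (pos ∷ v) = ∈-concatMap⁺ (extensions k) {signs} (there (there (here (∈-map⁺ _ (∈-allSigns v)))))

signedSum-∈ : ∀ h {k} (As : Vec ℤ k) {v} → weight v ≡ h →
  signedSum v As ∈ deduplicate ℤ._≟_ (restrictedSignedSumList h As)
signedSum-∈ h As {v} wv≡h = ∈-deduplicate⁺ ℤ._≟_ (∈-map⁺ (λ w → signedSum w As)
  (∈-filter⁺ (λ w → T? ⌊ weight w ℕ.≟ h ⌋) (∈-allSigns v) (fromWitness wv≡h)))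

length≤restrictedSignedSumsetSize : ∀ h {k} (As : Vec ℤ k) (vs : List (Vec Sign k)) →
  All (λ v → weight v ≡ h) vs → Unique (map (λ v → signedSum v As) vs) →
  length vs ≤ restrictedSignedSumsetSize h As
length≤restrictedSignedSumsetSize h As vs weights distinct =
  subst (_≤ _) (List.length-map _ vs) (Unique-⊆⇒length-≤ distinct sums⊆sumset)
  where
  sums⊆sumset : map (λ v → signedSum v As) vs ⊆ deduplicate ℤ._≟_ (restrictedSignedSumList h As)
  sums⊆sumset s∈sums with v , v∈vs , refl ← ∈-map⁻ _ s∈sums =
    signedSum-∈ h As {v} (All.lookup weights v∈vs)

Form : Set
Form = ℤ × ℤ

eval : ℤ → ℤ → Form → ℤ
eval A D (p , q) = p ℤ.* A ℤ.+ q ℤ.* D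

_-ᶠ_ : Form → Form → Form
(p , q) -ᶠ (p′ , q′) = p ℤ.+ ℤ.- p′ , q ℤ.+ ℤ.- q′

Represents : ℤ → ℤ → ∀ {k} → Vec ℤ k → Vec Form k → Set
Represents A D = Pointwise (λ x f → x ≡ eval A D f)

signedSumᶠ : ∀ {k} → Vec Sign k → Vec Form k → Form
signedSumᶠ v T = signedSum v (Vec.map proj₁ T) , signedSum v (Vec.map proj₂ T)

act-eval : ∀ A D s f → act s (eval A D f) ≡ eval A D (act s (proj₁ f) , act s (proj₂ f))
act-eval A D neg (p , q) = neg-eval p q A D
  where
  neg-eval : ∀ p q A D → ℤ.- (p ℤ.* A ℤ.+ q ℤ.* D) ≡ ℤ.- p ℤ.* A ℤ.+ ℤ.- q ℤ.* D
  neg-eval = solve-∀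
act-eval A D zer (p , q) = zero-eval A D
  where
  zero-eval : ∀ A D → 0ℤ ≡ 0ℤ ℤ.* A ℤ.+ 0ℤ ℤ.* D
  zero-eval = solve-∀
act-eval A D pos f = refl

eval-+ : ∀ A D f g → eval A D f ℤ.+ eval A D g ≡ eval A D (proj₁ f ℤ.+ proj₁ g , proj₂ f ℤ.+ proj₂ g)
eval-+ A D (p , q) (p′ , q′) = lemma p q p′ q′ A D
  where
  lemma : ∀ p q p′ q′ A D →
    (p ℤ.* A ℤ.+ q ℤ.* D) ℤ.+ (p′ ℤ.* A ℤ.+ q′ ℤ.* D) ≡ (p ℤ.+ p′) ℤ.* A ℤ.+ (q ℤ.+ q′) ℤ.* D
  lemma = solve-∀

eval-split : ∀ A D f g → eval A D g ≡ eval A D f ℤ.+ eval A D (g -ᶠ f)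
eval-split A D (p , q) (p′ , q′) = lemma p q p′ q′ A D
  where
  lemma : ∀ p q p′ q′ A D →
    p′ ℤ.* A ℤ.+ q′ ℤ.* D ≡ (p ℤ.* A ℤ.+ q ℤ.* D) ℤ.+ ((p′ ℤ.+ ℤ.- p) ℤ.* A ℤ.+ (q′ ℤ.+ ℤ.- q) ℤ.* D)
  lemma = solve-∀

a≡eval[1,0] : ∀ A D → A ≡ eval A D (+ 1 , + 0)
a≡eval[1,0] = lemma
  where
  lemma : ∀ A D → A ≡ + 1 ℤ.* A ℤ.+ + 0 ℤ.* D
  lemma = solve-∀

signedSum-eval : ∀ {A D k} {As : Vec ℤ k} {T : Vec Form k} →
  Represents A D As T → ∀ v → signedSum v As ≡ eval A D (signedSumᶠ v T)
signedSum-eval {A} {D} [] [] = act-eval A D zer (0ℤ , 0ℤ)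
signedSum-eval {A} {D} {As = x ∷ As} {f ∷ T} (x≡f ∷ As≡T) (s ∷ v) = begin
  act s x ℤ.+ signedSum v As
    ≡⟨ cong₂ ℤ._+_ (trans (cong (act s) x≡f) (act-eval A D s f)) (signedSum-eval As≡T v) ⟩
  eval A D (act s (proj₁ f) , act s (proj₂ f)) ℤ.+ eval A D (signedSumᶠ v T)
    ≡⟨ eval-+ A D (act s (proj₁ f) , act s (proj₂ f)) (signedSumᶠ v T) ⟩
  eval A D (signedSumᶠ (s ∷ v) (f ∷ T)) ∎
  where open ≡-Reasoning

NonNegNonZero : ℤ → ℤ → Set
NonNegNonZero x y = 0ℤ ℤ.≤ x × 0ℤ ℤ.≤ y × 0ℤ ℤ.< x ℤ.+ y

nonNegNonZero? : ∀ x y → Dec (NonNegNonZero x y)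
nonNegNonZero? x y = 0ℤ ℤ.≤? x ×-dec 0ℤ ℤ.≤? y ×-dec 0ℤ ℤ.<? x ℤ.+ y

0<m*u+n*w : ∀ m n {u w} → 0 < u → 0 < w → 0 < m ℕ.+ n → 0 < m * u ℕ.+ n * w
0<m*u+n*w (suc m) n       (s≤s z≤n) _         _ = s≤s z≤n
0<m*u+n*w zero    (suc n) _         (s≤s z≤n) _ = s≤s z≤n

NonNegNonZero⇒0<eval : ∀ {U V x y} → 0ℤ ℤ.< U → 0ℤ ℤ.< V → NonNegNonZero x y → 0ℤ ℤ.< eval U V (x , y)
NonNegNonZero⇒0<eval {+ u} {+ w} {+ m} {+ n} (ℤ.+<+ 0<u) (ℤ.+<+ 0<w) (ℤ.+≤+ _ , ℤ.+≤+ _ , ℤ.+<+ 0<m+n) =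
  subst (0ℤ ℤ.<_) (cong₂ ℤ._+_ (ℤ.pos-* m u) (ℤ.pos-* n w)) (ℤ.+<+ (0<m*u+n*w m n 0<u 0<w 0<m+n))

data Regime : Set where
  short long : Regime

InRegime : Regime → ℕ → ℕ → Set
InRegime short a d = ∃[ e ] 0 < e × 0 < d × d ℕ.+ e ≡ 2 * a
InRegime long  a d = ∃[ e ] 0 < e × 0 < a × 2 * a ℕ.+ e ≡ d

regime : ∀ {a d} → 0 < a → 0 < d → d ≢ 2 * a → ∃[ r ] InRegime r a d
regime {a} {d} 0<a 0<d d≢2a with ℕ.<-cmp d (2 * a)
... | tri< d<2a _ _ = short , 2 * a ∸ d , ℕ.m<n⇒0<n∸m d<2a , 0<d , ℕ.m+[n∸m]≡n (ℕ.<⇒≤ d<2a)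
... | tri≈ _ d≡2a _ = ⊥-elim (d≢2a d≡2a)
... | tri> _ _ 2a<d = long , d ∸ 2 * a , ℕ.m<n⇒0<n∸m 2a<d , 0<a , ℕ.m+[n∸m]≡n (ℕ.<⇒≤ 2a<d)

-- With e = ∣d − 2a∣: 2 (p a + q d) = p e + (p + 2q) d if d < 2a, and p a + q d = (p + 2q) a + q e if d > 2a.
PositiveIn : Regime → Form → Set
PositiveIn short (p , q) = NonNegNonZero p (p ℤ.+ + 2 ℤ.* q)
PositiveIn long  (p , q) = NonNegNonZero (p ℤ.+ + 2 ℤ.* q) q

positiveIn? : ∀ r f → Dec (PositiveIn r f)
positiveIn? short (p , q) = nonNegNonZero? p (p ℤ.+ + 2 ℤ.* q)
positiveIn? long  (p , q) = nonNegNonZero? (p ℤ.+ + 2 ℤ.* q) q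

PositiveIn⇒0<eval : ∀ {r a d} → InRegime r a d → ∀ {f} → PositiveIn r f → 0ℤ ℤ.< eval (+ a) (+ d) f
PositiveIn⇒0<eval {short} {a} {d} (e , 0<e , 0<d , d+e≡2a) {p , q} positive =
  ℤ.*-cancelˡ-<-nonNeg (+ 2) (subst (0ℤ ℤ.<_) twice-eval (NonNegNonZero⇒0<eval (ℤ.+<+ 0<e) (ℤ.+<+ 0<d) positive))
  where
  open ≡-Reasoning
  A D E : ℤ
  A = + a
  D = + d
  E = + e
  D+E≡2A : D ℤ.+ E ≡ + 2 ℤ.* A
  D+E≡2A = trans (cong +_ d+e≡2a) (ℤ.pos-* 2 a)
  regroup : ∀ p q D E → p ℤ.* E ℤ.+ (p ℤ.+ + 2 ℤ.* q) ℤ.* D ≡ p ℤ.* (D ℤ.+ E) ℤ.+ + 2 ℤ.* (q ℤ.* D)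
  regroup = solve-∀
  factor : ∀ p q A D → p ℤ.* (+ 2 ℤ.* A) ℤ.+ + 2 ℤ.* (q ℤ.* D) ≡ + 2 ℤ.* (p ℤ.* A ℤ.+ q ℤ.* D)
  factor = solve-∀
  twice-eval : eval E D (p , p ℤ.+ + 2 ℤ.* q) ≡ + 2 ℤ.* eval A D (p , q)
  twice-eval = begin
    p ℤ.* E ℤ.+ (p ℤ.+ + 2 ℤ.* q) ℤ.* D ≡⟨ regroup p q D E ⟩
    p ℤ.* (D ℤ.+ E) ℤ.+ + 2 ℤ.* (q ℤ.* D) ≡⟨ cong (λ t → p ℤ.* t ℤ.+ + 2 ℤ.* (q ℤ.* D)) D+E≡2A ⟩
    p ℤ.* (+ 2 ℤ.* A) ℤ.+ + 2 ℤ.* (q ℤ.* D) ≡⟨ factor p q A D ⟩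
    + 2 ℤ.* (p ℤ.* A ℤ.+ q ℤ.* D) ∎
PositiveIn⇒0<eval {long} {a} {d} (e , 0<e , 0<a , 2a+e≡d) {p , q} positive =
  subst (0ℤ ℤ.<_) same-eval (NonNegNonZero⇒0<eval (ℤ.+<+ 0<a) (ℤ.+<+ 0<e) positive)
  where
  open ≡-Reasoning
  A D E : ℤ
  A = + a
  D = + d
  E = + e
  2A+E≡D : + 2 ℤ.* A ℤ.+ E ≡ D
  2A+E≡D = trans (cong (ℤ._+ E) (sym (ℤ.pos-* 2 a))) (cong +_ 2a+e≡d)
  regroup : ∀ p q A E → (p ℤ.+ + 2 ℤ.* q) ℤ.* A ℤ.+ q ℤ.* E ≡ p ℤ.* A ℤ.+ q ℤ.* (+ 2 ℤ.* A ℤ.+ E)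
  regroup = solve-∀
  same-eval : eval A E (p ℤ.+ + 2 ℤ.* q , q) ≡ eval A D (p , q)
  same-eval = begin
    (p ℤ.+ + 2 ℤ.* q) ℤ.* A ℤ.+ q ℤ.* E ≡⟨ regroup p q A E ⟩
    p ℤ.* A ℤ.+ q ℤ.* (+ 2 ℤ.* A ℤ.+ E) ≡⟨ cong (λ t → p ℤ.* A ℤ.+ q ℤ.* t) 2A+E≡D ⟩
    p ℤ.* A ℤ.+ q ℤ.* D ∎

Increases : Regime → ∀ {k} → Vec Form k → Rel (Vec Sign k) 0ℓ
Increases r T v w = PositiveIn r (signedSumᶠ w T -ᶠ signedSumᶠ v T)

increases⇒< : ∀ {r a d k} {As : Vec ℤ k} {T : Vec Form k} → InRegime r a d → Represents (+ a) (+ d) As T →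
  ∀ v w → Increases r T v w → signedSum v As ℤ.< signedSum w As
increases⇒< {a = a} {d} {As = As} {T} inRegime As≡T v w v↗w =
  subst₂ ℤ._<_ (sym (signedSum-eval As≡T v)) (sym (signedSum-eval As≡T w)) evalv<evalw
  where
  f g : Form
  f = signedSumᶠ v T
  g = signedSumᶠ w T
  evalv<evalw : eval (+ a) (+ d) f ℤ.< eval (+ a) (+ d) g
  evalv<evalw = subst₂ ℤ._<_ (ℤ.+-identityʳ _) (sym (eval-split (+ a) (+ d) f g))
    (ℤ.+-monoʳ-< (eval (+ a) (+ d) f) (PositiveIn⇒0<eval inRegime v↗w))

Certificate : ℕ → Regime → ∀ {k} → Vec Form k → List (Vec Sign k) → Set
Certificate h r T vs = All (λ v → weight v ≡ h) vs × Linked (Increases r T) vs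

certificate? : ∀ h r {k} (T : Vec Form k) vs → Dec (Certificate h r T vs)
certificate? h r T vs =
  All.all? (λ v → weight v ℕ.≟ h) vs ×-dec Linked.linked? (λ v w → positiveIn? r _) vs

certificate⇒length≤ : ∀ {h r a d k} {As : Vec ℤ k} {T : Vec Form k} {vs} →
  InRegime r a d → Represents (+ a) (+ d) As T → Certificate h r T vs →
  length vs ≤ restrictedSignedSumsetSize h As
certificate⇒length≤ {h} {As = As} {vs = vs} inRegime As≡T (weights , increasing) =
  length≤restrictedSignedSumsetSize h As vs weights
    (AllPairs.map ℤ.<⇒≢ (Linked.Linked⇒AllPairs ℤ.<-trans
      (Linked.map⁺ (Linked.map (λ {v} {w} → increases⇒< inRegime As≡T v w) increasing))))

data Gap : Set where
  regular odd : Gap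

gapSize : ℕ → ℕ → Gap → ℕ
gapSize a d regular = 2 * a
gapSize a d odd     = d

oddAt : ∀ {n} → Fin n → Vec Gap n
oddAt i = replicate _ regular [ i ]≔ odd

gapSize-oddAt : ∀ {n a} (g : Fin n → ℕ) i → (∀ j → j ≢ i → g j ≡ 2 * a) →
  ∀ j → g j ≡ gapSize a (g i) (lookup (oddAt i) j)
gapSize-oddAt {a = a} g i regularElsewhere j with j ≟ i
... | yes refl = cong (gapSize a (g i)) (sym (Vec.lookup∘update i (replicate _ regular) odd))
... | no j≢i   = trans (regularElsewhere j j≢i) (cong (gapSize a (g i)) (sym (begin
  lookup (oddAt i) j           ≡⟨ Vec.lookup∘update′ j≢i (replicate _ regular) odd ⟩
  lookup (replicate _ regular) j ≡⟨ Vec.lookup-replicate j regular ⟩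
  regular                       ∎)))
  where open ≡-Reasoning

data Climbs (a d : ℕ) : ∀ {n} → Vec ℕ (suc n) → Vec Gap n → Set where
  [_] : ∀ x → Climbs a d (x ∷ []) []
  _∷_ : ∀ {n x y g} {xs : Vec ℕ n} {gs} →
        y ≡ x ℕ.+ gapSize a d g → Climbs a d (y ∷ xs) gs → Climbs a d (x ∷ y ∷ xs) (g ∷ gs)

advance : Form → Gap → Form
advance (p , q) regular = p ℤ.+ + 2 , q
advance (p , q) odd     = p , q ℤ.+ + 1

ladder : ∀ {n} → Form → Vec Gap n → Vec Form (suc n)
ladder f []       = f ∷ []
ladder f (g ∷ gs) = f ∷ ladder (advance f g) gs

advance-represents : ∀ {a d x y} g {f} → y ≡ x ℕ.+ gapSize a d g →
  + x ≡ eval (+ a) (+ d) f → + y ≡ eval (+ a) (+ d) (advance f g)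
advance-represents {a} {d} {x} regular {p , q} refl x≡f = begin
  + x ℤ.+ + (2 * a)                  ≡⟨ cong₂ ℤ._+_ x≡f (ℤ.pos-* 2 a) ⟩
  eval A D (p , q) ℤ.+ + 2 ℤ.* A    ≡⟨ lemma p q A D ⟩
  eval A D (p ℤ.+ + 2 , q)          ∎
  where
  open ≡-Reasoning
  A D : ℤ
  A = + a
  D = + d
  lemma : ∀ p q A D → (p ℤ.* A ℤ.+ q ℤ.* D) ℤ.+ + 2 ℤ.* A ≡ (p ℤ.+ + 2) ℤ.* A ℤ.+ q ℤ.* D
  lemma = solve-∀
advance-represents {a} {d} {x} odd {p , q} refl x≡f = begin
  + x ℤ.+ + d                  ≡⟨ cong (ℤ._+ + d) x≡f ⟩
  eval (+ a) (+ d) (p , q) ℤ.+ + d ≡⟨ lemma p q (+ a) (+ d) ⟩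
  eval (+ a) (+ d) (p , q ℤ.+ + 1) ∎
  where
  open ≡-Reasoning
  lemma : ∀ p q A D → (p ℤ.* A ℤ.+ q ℤ.* D) ℤ.+ D ≡ p ℤ.* A ℤ.+ (q ℤ.+ + 1) ℤ.* D
  lemma = solve-∀

climbs-represents : ∀ {a d n} {xs : Vec ℕ (suc n)} {gs f} → Climbs a d xs gs →
  + Vec.head xs ≡ eval (+ a) (+ d) f → Represents (+ a) (+ d) (Vec.map +_ xs) (ladder f gs)
climbs-represents [ x ]         x≡f = x≡f ∷ []
climbs-represents {a} {d} {f = f} (_∷_ {g = g} y≡x+g ys) x≡f =
  x≡f ∷ climbs-represents ys (advance-represents {a} {d} g {f} y≡x+g x≡f)

gapAt-climbs : ∀ {a₁ a₂ a₃ a₄ a₅ d} {gs : Vec Gap 4} → a₁ < a₂ → a₂ < a₃ → a₃ < a₄ → a₄ < a₅ →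
  (∀ j → gapAt a₁ a₂ a₃ a₄ a₅ j ≡ gapSize a₁ d (lookup gs j)) →
  Climbs a₁ d (a₁ ∷ a₂ ∷ a₃ ∷ a₄ ∷ a₅ ∷ []) gs
gapAt-climbs {a₅ = a₅} {gs = _ ∷ _ ∷ _ ∷ _ ∷ []} a₁<a₂ a₂<a₃ a₃<a₄ a₄<a₅ gaps =
  step a₁<a₂ (gaps 0F) ∷ step a₂<a₃ (gaps 1F) ∷ step a₃<a₄ (gaps 2F) ∷ step a₄<a₅ (gaps 3F) ∷ [ a₅ ]
  where
  step : ∀ {x y s} → x < y → y ∸ x ≡ s → y ≡ x ℕ.+ s
  step x<y refl = sym (ℕ.m+[n∸m]≡n (ℕ.<⇒≤ x<y))

0<gapAt : ∀ {a₁ a₂ a₃ a₄ a₅} → a₁ < a₂ → a₂ < a₃ → a₃ < a₄ → a₄ < a₅ →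
  ∀ j → 0 < gapAt a₁ a₂ a₃ a₄ a₅ j
0<gapAt a₁<a₂ _ _ _ 0F = ℕ.m<n⇒0<n∸m a₁<a₂
0<gapAt _ a₂<a₃ _ _ 1F = ℕ.m<n⇒0<n∸m a₂<a₃
0<gapAt _ _ a₃<a₄ _ 2F = ℕ.m<n⇒0<n∸m a₃<a₄
0<gapAt _ _ _ a₄<a₅ 3F = ℕ.m<n⇒0<n∸m a₄<a₅

⟨_,_,_,_,_⟩ : Sign → Sign → Sign → Sign → Sign → Vec Sign 5
⟨ s₁ , s₂ , s₃ , s₄ , s₅ ⟩ = s₁ ∷ s₂ ∷ s₃ ∷ s₄ ∷ s₅ ∷ []

chain : Regime → Fin 4 → Vec (Vec Sign 5) 26
chain short 0F =
  ⟨ zer , neg , neg , neg , neg ⟩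
  ∷ ⟨ neg , zer , neg , neg , neg ⟩
  ∷ ⟨ neg , neg , zer , neg , neg ⟩
  ∷ ⟨ zer , pos , neg , neg , neg ⟩
  ∷ ⟨ neg , neg , neg , zer , neg ⟩
  ∷ ⟨ neg , pos , zer , neg , neg ⟩
  ∷ ⟨ zer , neg , pos , neg , neg ⟩
  ∷ ⟨ neg , zer , pos , neg , neg ⟩
  ∷ ⟨ neg , pos , neg , neg , zer ⟩
  ∷ ⟨ zer , pos , pos , neg , neg ⟩
  ∷ ⟨ neg , neg , pos , zer , neg ⟩
  ∷ ⟨ neg , neg , zer , pos , neg ⟩
  ∷ ⟨ zer , pos , neg , pos , neg ⟩
  ∷ ⟨ neg , pos , pos , zer , neg ⟩
  ∷ ⟨ neg , pos , zer , pos , neg ⟩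
  ∷ ⟨ zer , neg , pos , pos , neg ⟩
  ∷ ⟨ neg , zer , pos , pos , neg ⟩
  ∷ ⟨ neg , pos , neg , pos , zer ⟩
  ∷ ⟨ zer , pos , pos , pos , neg ⟩
  ∷ ⟨ neg , zer , pos , neg , pos ⟩
  ∷ ⟨ neg , neg , pos , pos , zer ⟩
  ∷ ⟨ zer , pos , pos , neg , pos ⟩
  ∷ ⟨ neg , neg , pos , zer , pos ⟩
  ∷ ⟨ neg , pos , pos , pos , zer ⟩
  ∷ ⟨ zer , pos , neg , pos , pos ⟩
  ∷ ⟨ neg , pos , pos , zer , pos ⟩
  ∷ []

chain long 0F =
  ⟨ zer , neg , neg , neg , neg ⟩
  ∷ ⟨ neg , zer , neg , neg , neg ⟩
  ∷ ⟨ neg , neg , zer , neg , neg ⟩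
  ∷ ⟨ neg , neg , neg , zer , neg ⟩
  ∷ ⟨ neg , neg , neg , neg , zer ⟩
  ∷ ⟨ pos , neg , neg , neg , zer ⟩
  ∷ ⟨ zer , neg , pos , neg , neg ⟩
  ∷ ⟨ neg , pos , zer , neg , neg ⟩
  ∷ ⟨ neg , zer , pos , neg , neg ⟩
  ∷ ⟨ neg , pos , neg , neg , zer ⟩
  ∷ ⟨ neg , neg , pos , zer , neg ⟩
  ∷ ⟨ neg , neg , zer , pos , neg ⟩
  ∷ ⟨ neg , zer , neg , neg , pos ⟩
  ∷ ⟨ neg , neg , neg , pos , zer ⟩
  ∷ ⟨ neg , neg , neg , zer , pos ⟩
  ∷ ⟨ zer , neg , pos , pos , neg ⟩
  ∷ ⟨ neg , pos , zer , pos , neg ⟩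
  ∷ ⟨ neg , zer , pos , pos , neg ⟩
  ∷ ⟨ neg , pos , neg , pos , zer ⟩
  ∷ ⟨ neg , zer , pos , neg , pos ⟩
  ∷ ⟨ neg , neg , pos , pos , zer ⟩
  ∷ ⟨ neg , neg , pos , zer , pos ⟩
  ∷ ⟨ neg , neg , zer , pos , pos ⟩
  ∷ ⟨ pos , neg , zer , pos , pos ⟩
  ∷ ⟨ zer , pos , neg , pos , pos ⟩
  ∷ ⟨ neg , pos , pos , pos , zer ⟩
  ∷ []

chain short 1F =
  ⟨ zer , neg , neg , neg , neg ⟩
  ∷ ⟨ neg , zer , neg , neg , neg ⟩
  ∷ ⟨ neg , neg , zer , neg , neg ⟩
  ∷ ⟨ pos , zer , neg , neg , neg ⟩
  ∷ ⟨ neg , neg , neg , zer , neg ⟩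
  ∷ ⟨ zer , pos , neg , neg , neg ⟩
  ∷ ⟨ neg , neg , neg , neg , zer ⟩
  ∷ ⟨ zer , neg , pos , neg , neg ⟩
  ∷ ⟨ neg , pos , zer , neg , neg ⟩
  ∷ ⟨ neg , zer , pos , neg , neg ⟩
  ∷ ⟨ neg , pos , neg , zer , neg ⟩
  ∷ ⟨ zer , neg , neg , pos , neg ⟩
  ∷ ⟨ neg , neg , pos , zer , neg ⟩
  ∷ ⟨ neg , zer , neg , pos , neg ⟩
  ∷ ⟨ neg , neg , zer , pos , neg ⟩
  ∷ ⟨ zer , neg , neg , neg , pos ⟩
  ∷ ⟨ pos , neg , zer , pos , neg ⟩
  ∷ ⟨ neg , zer , neg , neg , pos ⟩
  ∷ ⟨ neg , neg , neg , pos , zer ⟩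
  ∷ ⟨ zer , neg , pos , pos , neg ⟩
  ∷ ⟨ neg , neg , neg , zer , pos ⟩
  ∷ ⟨ neg , zer , pos , pos , neg ⟩
  ∷ ⟨ pos , neg , neg , zer , pos ⟩
  ∷ ⟨ zer , neg , pos , neg , pos ⟩
  ∷ ⟨ neg , pos , neg , pos , zer ⟩
  ∷ ⟨ neg , zer , pos , neg , pos ⟩
  ∷ []

chain long 1F =
  ⟨ zer , neg , neg , neg , neg ⟩
  ∷ ⟨ neg , zer , neg , neg , neg ⟩
  ∷ ⟨ pos , zer , neg , neg , neg ⟩
  ∷ ⟨ neg , neg , zer , neg , neg ⟩
  ∷ ⟨ neg , neg , neg , zer , neg ⟩
  ∷ ⟨ neg , neg , neg , neg , zer ⟩
  ∷ ⟨ neg , pos , zer , neg , neg ⟩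
  ∷ ⟨ zer , neg , pos , neg , neg ⟩
  ∷ ⟨ neg , zer , pos , neg , neg ⟩
  ∷ ⟨ zer , neg , neg , pos , neg ⟩
  ∷ ⟨ neg , zer , neg , pos , neg ⟩
  ∷ ⟨ neg , neg , pos , zer , neg ⟩
  ∷ ⟨ neg , neg , zer , pos , neg ⟩
  ∷ ⟨ pos , neg , zer , pos , neg ⟩
  ∷ ⟨ neg , neg , neg , pos , zer ⟩
  ∷ ⟨ neg , neg , neg , zer , pos ⟩
  ∷ ⟨ zer , neg , pos , pos , neg ⟩
  ∷ ⟨ neg , zer , pos , pos , neg ⟩
  ∷ ⟨ zer , neg , pos , neg , pos ⟩
  ∷ ⟨ neg , zer , pos , neg , pos ⟩
  ∷ ⟨ zer , neg , neg , pos , pos ⟩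
  ∷ ⟨ neg , neg , pos , pos , zer ⟩
  ∷ ⟨ neg , neg , pos , zer , pos ⟩
  ∷ ⟨ neg , neg , zer , pos , pos ⟩
  ∷ ⟨ neg , pos , pos , pos , zer ⟩
  ∷ ⟨ neg , pos , pos , zer , pos ⟩
  ∷ []

chain short 2F =
  ⟨ zer , neg , neg , neg , neg ⟩
  ∷ ⟨ neg , zer , neg , neg , neg ⟩
  ∷ ⟨ neg , neg , zer , neg , neg ⟩
  ∷ ⟨ neg , neg , neg , zer , neg ⟩
  ∷ ⟨ zer , pos , neg , neg , neg ⟩
  ∷ ⟨ neg , neg , neg , neg , zer ⟩
  ∷ ⟨ pos , neg , neg , neg , zer ⟩
  ∷ ⟨ neg , pos , zer , neg , neg ⟩
  ∷ ⟨ neg , pos , neg , zer , neg ⟩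
  ∷ ⟨ zer , neg , neg , pos , neg ⟩
  ∷ ⟨ neg , pos , neg , neg , zer ⟩
  ∷ ⟨ neg , zer , neg , pos , neg ⟩
  ∷ ⟨ neg , neg , pos , zer , neg ⟩
  ∷ ⟨ neg , neg , zer , pos , neg ⟩
  ∷ ⟨ neg , neg , pos , neg , zer ⟩
  ∷ ⟨ neg , zer , neg , neg , pos ⟩
  ∷ ⟨ neg , neg , neg , pos , zer ⟩
  ∷ ⟨ neg , neg , zer , neg , pos ⟩
  ∷ ⟨ neg , neg , neg , zer , pos ⟩
  ∷ ⟨ neg , pos , zer , pos , neg ⟩
  ∷ ⟨ pos , neg , neg , zer , pos ⟩
  ∷ ⟨ neg , zer , pos , pos , neg ⟩
  ∷ ⟨ neg , pos , neg , pos , zer ⟩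
  ∷ ⟨ neg , pos , zer , neg , pos ⟩
  ∷ ⟨ neg , pos , neg , zer , pos ⟩
  ∷ ⟨ zer , neg , neg , pos , pos ⟩
  ∷ []

chain long 2F =
  ⟨ zer , neg , neg , neg , neg ⟩
  ∷ ⟨ neg , zer , neg , neg , neg ⟩
  ∷ ⟨ neg , neg , zer , neg , neg ⟩
  ∷ ⟨ zer , pos , neg , neg , neg ⟩
  ∷ ⟨ neg , neg , neg , zer , neg ⟩
  ∷ ⟨ neg , neg , neg , neg , zer ⟩
  ∷ ⟨ pos , neg , neg , neg , zer ⟩
  ∷ ⟨ neg , pos , neg , zer , neg ⟩
  ∷ ⟨ neg , pos , neg , neg , zer ⟩
  ∷ ⟨ zer , neg , neg , pos , neg ⟩
  ∷ ⟨ neg , zer , neg , pos , neg ⟩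
  ∷ ⟨ neg , neg , zer , pos , neg ⟩
  ∷ ⟨ neg , zer , neg , neg , pos ⟩
  ∷ ⟨ neg , neg , zer , neg , pos ⟩
  ∷ ⟨ neg , neg , neg , pos , zer ⟩
  ∷ ⟨ neg , neg , neg , zer , pos ⟩
  ∷ ⟨ pos , neg , neg , zer , pos ⟩
  ∷ ⟨ neg , pos , neg , pos , zer ⟩
  ∷ ⟨ neg , pos , neg , zer , pos ⟩
  ∷ ⟨ neg , neg , pos , pos , zer ⟩
  ∷ ⟨ neg , neg , pos , zer , pos ⟩
  ∷ ⟨ pos , neg , pos , zer , pos ⟩
  ∷ ⟨ neg , pos , pos , pos , zer ⟩
  ∷ ⟨ neg , pos , pos , zer , pos ⟩
  ∷ ⟨ pos , pos , pos , zer , pos ⟩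
  ∷ ⟨ neg , pos , zer , pos , pos ⟩
  ∷ []

chain short 3F =
  ⟨ zer , neg , neg , neg , neg ⟩
  ∷ ⟨ neg , zer , neg , neg , neg ⟩
  ∷ ⟨ neg , neg , zer , neg , neg ⟩
  ∷ ⟨ neg , neg , neg , zer , neg ⟩
  ∷ ⟨ neg , neg , neg , neg , zer ⟩
  ∷ ⟨ pos , neg , neg , zer , neg ⟩
  ∷ ⟨ pos , neg , neg , neg , zer ⟩
  ∷ ⟨ neg , pos , zer , neg , neg ⟩
  ∷ ⟨ neg , zer , pos , neg , neg ⟩
  ∷ ⟨ neg , pos , neg , neg , zer ⟩
  ∷ ⟨ zer , neg , neg , pos , neg ⟩
  ∷ ⟨ pos , pos , neg , neg , zer ⟩
  ∷ ⟨ zer , neg , neg , neg , pos ⟩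
  ∷ ⟨ neg , neg , pos , neg , zer ⟩
  ∷ ⟨ neg , zer , neg , neg , pos ⟩
  ∷ ⟨ pos , neg , pos , neg , zer ⟩
  ∷ ⟨ neg , neg , zer , neg , pos ⟩
  ∷ ⟨ neg , neg , neg , pos , zer ⟩
  ∷ ⟨ neg , neg , neg , zer , pos ⟩
  ∷ ⟨ neg , pos , pos , neg , zer ⟩
  ∷ ⟨ pos , neg , neg , zer , pos ⟩
  ∷ ⟨ pos , pos , pos , neg , zer ⟩
  ∷ ⟨ neg , pos , zer , neg , pos ⟩
  ∷ ⟨ neg , pos , neg , pos , zer ⟩
  ∷ ⟨ neg , zer , pos , neg , pos ⟩
  ∷ ⟨ pos , pos , neg , pos , zer ⟩
  ∷ []

chain long 3F =
  ⟨ zer , neg , neg , neg , neg ⟩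
  ∷ ⟨ neg , zer , neg , neg , neg ⟩
  ∷ ⟨ neg , neg , zer , neg , neg ⟩
  ∷ ⟨ neg , neg , neg , zer , neg ⟩
  ∷ ⟨ pos , neg , neg , zer , neg ⟩
  ∷ ⟨ neg , pos , zer , neg , neg ⟩
  ∷ ⟨ neg , zer , pos , neg , neg ⟩
  ∷ ⟨ zer , neg , neg , pos , neg ⟩
  ∷ ⟨ neg , pos , neg , neg , zer ⟩
  ∷ ⟨ pos , pos , neg , neg , zer ⟩
  ∷ ⟨ neg , neg , pos , neg , zer ⟩
  ∷ ⟨ zer , neg , neg , neg , pos ⟩
  ∷ ⟨ neg , zer , neg , neg , pos ⟩
  ∷ ⟨ neg , neg , zer , neg , pos ⟩
  ∷ ⟨ neg , neg , neg , zer , pos ⟩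
  ∷ ⟨ pos , neg , neg , zer , pos ⟩
  ∷ ⟨ neg , pos , zer , neg , pos ⟩
  ∷ ⟨ neg , zer , pos , neg , pos ⟩
  ∷ ⟨ zer , neg , neg , pos , pos ⟩
  ∷ ⟨ neg , neg , pos , zer , pos ⟩
  ∷ ⟨ neg , neg , zer , pos , pos ⟩
  ∷ ⟨ zer , pos , neg , pos , pos ⟩
  ∷ ⟨ neg , pos , pos , zer , pos ⟩
  ∷ ⟨ neg , pos , zer , pos , pos ⟩
  ∷ ⟨ neg , zer , pos , pos , pos ⟩
  ∷ ⟨ pos , zer , pos , pos , pos ⟩
  ∷ []

certified : ∀ r i → Certificate 4 r (ladder (+ 1 , + 0) (oddAt i)) (toList (chain r i))
certified short = toWitness {a? = Fin.all? λ i → certificate? 4 short _ _} _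
certified long  = toWitness {a? = Fin.all? λ i → certificate? 4 long _ _} _

lemma3p3 : (a₁ a₂ a₃ a₄ a₅ : ℕ) → 0 < a₁ → a₁ < a₂ → a₂ < a₃ → a₃ < a₄ → a₄ < a₅ →
    (∃ λ (i : Fin 4) → gapAt a₁ a₂ a₃ a₄ a₅ i ≢ 2 * a₁ ×
      ((j : Fin 4) → j ≢ i → gapAt a₁ a₂ a₃ a₄ a₅ j ≡ 2 * a₁)) →
    26 ≤ restrictedSignedSumsetSize 4 (+ a₁ ∷ + a₂ ∷ + a₃ ∷ + a₄ ∷ + a₅ ∷ [])
lemma3p3 a₁ a₂ a₃ a₄ a₅ 0<a₁ a₁<a₂ a₂<a₃ a₃<a₄ a₄<a₅ (i , gᵢ≢2a₁ , regularElsewhere)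
  with r , inRegime ← regime 0<a₁ (0<gapAt a₁<a₂ a₂<a₃ a₃<a₄ a₄<a₅ i) gᵢ≢2a₁ =
  subst (_≤ _) (Vec.length-toList (chain r i)) (certificate⇒length≤ inRegime represents (certified r i))
  where
  g : Fin 4 → ℕ
  g = gapAt a₁ a₂ a₃ a₄ a₅
  represents : Represents (+ a₁) (+ g i) (+ a₁ ∷ + a₂ ∷ + a₃ ∷ + a₄ ∷ + a₅ ∷ []) (ladder (+ 1 , + 0) (oddAt i))
  represents = climbs-represents (gapAt-climbs a₁<a₂ a₂<a₃ a₃<a₄ a₄<a₅ (gapSize-oddAt g i regularElsewhere))
    (a≡eval[1,0] (+ a₁) (+ g i))
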